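{- Let $E$ be a finite set and $\tau:2^{E}\to2^{E}$ an operator satisfying (C1) $X\subseteq\tau(X)$ for all $X\subseteq E$, and (Convexity) for all $X\subseteq Y\subseteq Z\subseteq E$ with $\tau(X)=\tau(Z)$, $\tau(Y)=\tau(X)=\tau(Z)$ (a convex space). Suppose $(E,\tau)$ is uniquely generated and has unique maximal generators, i.e. for every $A\subseteq E$ the family $\{Y\subseteq E:\tau(Y)=\tau(A)\}$ has a unique inclusion-maximal member $G_{Max}(A)$. Call $X,Y\subseteq E$ equivalent if $\tau(X)=\tau(Y)$. Then the partition of $2^{E}$ into equivalence classes is a hypercube partition of $2^{E}$; more precisely, for every $A\subseteq E$ the class $\{X\subseteq E:\tau(X)=\tau(A)\}$ equals the interval $[B_A,G_{Max}(A)]$, where $B_A$ is the unique basis of $A$.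
   Context: For sets $A\subseteq B\subseteq E$, the interval $[A,B]$ is $\{C\subseteq E: A\subseteq C\subseteq B\}$. A hypercube partition of $2^{E}$ is a partition of $2^{E}$ into pairwise disjoint intervals. A generator of $X$ is any $B\subseteq E$ with $\tau(B)=\tau(X)$; a basis of $X$ is an inclusion-minimal generator of $X$; $(E,\tau)$ is uniquely generated if every $X\subseteq E$ has exactly one basis. -}

module Defs where

open import Data.Nat using (ℕ)
open import Data.Fin.Subset using (Subset; _⊆_)
open import Data.Product using (_×_; Σ; ∃-syntax)
open import Relation.Binary.PropositionalEquality using (_≡_)

-- Ground set E = Fin n; subsets of E are `Subset n`; an operator τ : 2^E → 2^E.
Operator : ℕ → Set
Operator n = Subset n → Subset n

Extensive : ∀ {n} → Operator n → Set
Extensive {n} τ = (X : Subset n) → X ⊆ τ X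

Convex : ∀ {n} → Operator n → Set
Convex {n} τ = (X Y Z : Subset n) → X ⊆ Y → Y ⊆ Z → τ X ≡ τ Z → τ Y ≡ τ X

IsConvexSpace : ∀ {n} → Operator n → Set
IsConvexSpace τ = Extensive τ × Convex τ

IsGenerator : ∀ {n} → Operator n → Subset n → Subset n → Set
IsGenerator τ X B = τ B ≡ τ X

IsBasis : ∀ {n} → Operator n → Subset n → Subset n → Set
IsBasis {n} τ X B =
  IsGenerator τ X B × ((C : Subset n) → IsGenerator τ X C → C ⊆ B → C ≡ B)

UniquelyGenerated : ∀ {n} → Operator n → Set
UniquelyGenerated {n} τ =
  (X : Subset n) → Σ (Subset n) λ B → IsBasis τ X B × ((B' : Subset n) → IsBasis τ X B' → B' ≡ B)

IsMaxGenerator : ∀ {n} → Operator n → Subset n → Subset n → Set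
IsMaxGenerator {n} τ A G =
  IsGenerator τ A G × ((C : Subset n) → IsGenerator τ A C → G ⊆ C → C ≡ G)

UniqueMaxGenerators : ∀ {n} → Operator n → Set
UniqueMaxGenerators {n} τ =
  (A : Subset n) → Σ (Subset n) λ G → IsMaxGenerator τ A G × ((G' : Subset n) → IsMaxGenerator τ A G' → G' ≡ G)

InInterval : ∀ {n} → Subset n → Subset n → Subset n → Set
InInterval B G C = B ⊆ C × C ⊆ G

module Submission where

--  * [B , G] lies in the class: this is convexity applied to B ⊆ X ⊆ G.
--  * The class lies in [B , G]: the powerset of a finite set is well founded
--    both under ⊂ and under ⊃, so inside the (decidable) class every X lies
--    above some inclusion-minimal member and below some inclusion-maximal
--    member.  These are a basis and a maximal generator of A, hence equal to
--    B and G by the uniqueness hypotheses; so B ⊆ X ⊆ G.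

open import Defs
open import Level using (Level)
open import Data.Nat using (ℕ; _<_)
open import Data.Nat.Induction using (<-wellFounded)
open import Data.Bool.Properties using () renaming (_≟_ to _≟ᵇ_)
open import Data.Vec.Properties using (≡-dec)
open import Data.Fin.Subset using (Subset; _⊆_; _⊂_; _⊃_; ∁; ∣_∣)
open import Data.Fin.Subset.Properties
  using (_∈?_; _⊂?_; ⊂-trans; ⊆-antisym; p⊂q⇒∣p∣<∣q∣; p⊂q⇒∁p⊃∁q; anySubset?)
open import Data.Product using (_×_; _,_; proj₁; ∃-syntax)
open import Data.Sum using (_⊎_; inj₁; inj₂)
open import Function using (id; flip)
open import Function.Bundles using (_⇔_; mk⇔)
open import Induction.WellFounded using (WellFounded; Acc; acc; module Subrelation)
open import Relation.Binary.Construct.On as On using ()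
open import Relation.Binary.Core using (Rel)
open import Relation.Binary.Definitions using (Transitive) renaming (Decidable to Decidable₂)
open import Relation.Binary.PropositionalEquality using (_≡_; refl; sym; trans; subst)
open import Relation.Nullary using (yes; no; ¬_; _×-dec_; contradiction)
open import Relation.Unary using (Pred; Decidable)

module _ {n : ℕ} where

  ⊆⇒≡⊎⊂ : {p q : Subset n} → p ⊆ q → p ≡ q ⊎ p ⊂ q
  ⊆⇒≡⊎⊂ {p} {q} p⊆q with p ⊂? q
  ... | yes p⊂q = inj₂ p⊂q
  ... | no p⊄q = inj₁ (⊆-antisym p⊆q q⊆p)
    where
    q⊆p : q ⊆ p
    q⊆p {x} x∈q with x ∈? p
    ... | yes x∈p = x∈p
    ... | no x∉p = contradiction ((λ {y} → p⊆q {y}) , x , x∈q , x∉p) p⊄q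

  -- Strict inclusion is well founded in both directions: it strictly
  -- increases the size of a set and strictly decreases that of its complement.
  ⊂-wellFounded : WellFounded (_⊂_ {n})
  ⊂-wellFounded = Subrelation.wellFounded p⊂q⇒∣p∣<∣q∣ (On.wellFounded ∣_∣ <-wellFounded)

  ⊃-wellFounded : WellFounded (_⊃_ {n})
  ⊃-wellFounded = Subrelation.wellFounded ∁-shrinks (On.wellFounded (λ p → ∣ ∁ p ∣) <-wellFounded)
    where
    ∁-shrinks : {p q : Subset n} → q ⊂ p → ∣ ∁ p ∣ < ∣ ∁ q ∣
    ∁-shrinks q⊂p = p⊂q⇒∣p∣<∣q∣ (p⊂q⇒∁p⊃∁q q⊂p)

  ≺-minimalBelow : {ℓ r : Level} {P : Pred (Subset n) ℓ} → Decidable P →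
    {_≺_ : Rel (Subset n) r} → Decidable₂ _≺_ → Transitive _≺_ →
    {C : Subset n} → Acc _≺_ C → P C →
    ∃[ D ] (D ≡ C ⊎ D ≺ C) × P D × ((C' : Subset n) → C' ≺ D → ¬ P C')
  ≺-minimalBelow P? _≺?_ ≺-trans {C} (acc below) PC
    with anySubset? (λ C' → (C' ≺? C) ×-dec P? C')
  ... | no none = C , inj₁ refl , PC , λ C' C'≺C PC' → none (C' , C'≺C , PC')
  ... | yes (C' , C'≺C , PC') with ≺-minimalBelow P? _≺?_ ≺-trans (below C'≺C) PC'
  ...   | D , inj₁ refl , PD , minimal = D , inj₂ C'≺C , PD , minimal
  ...   | D , inj₂ D≺C' , PD , minimal = D , inj₂ (≺-trans D≺C' C'≺C) , PD , minimal

  Minimal : {ℓ : Level} → Pred (Subset n) ℓ → Subset n → Set ℓ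
  Minimal P D = P D × ((C : Subset n) → P C → C ⊆ D → C ≡ D)

  Maximal : {ℓ : Level} → Pred (Subset n) ℓ → Subset n → Set ℓ
  Maximal P D = P D × ((C : Subset n) → P C → D ⊆ C → C ≡ D)

  minimalBelow : {ℓ : Level} {P : Pred (Subset n) ℓ} → Decidable P →
    {C : Subset n} → P C → ∃[ D ] D ⊆ C × Minimal P D
  minimalBelow {P = P} P? {C} PC with ≺-minimalBelow P? _⊂?_ ⊂-trans (⊂-wellFounded C) PC
  ... | D , D≼C , PD , none = D , D⊆C D≼C , PD , minimality
    where
    D⊆C : D ≡ C ⊎ D ⊂ C → D ⊆ C
    D⊆C (inj₁ refl) = id
    D⊆C (inj₂ (D⊆C , _)) = D⊆C

    minimality : (C' : Subset n) → P C' → C' ⊆ D → C' ≡ D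
    minimality C' PC' C'⊆D with ⊆⇒≡⊎⊂ C'⊆D
    ... | inj₁ C'≡D = C'≡D
    ... | inj₂ C'⊂D = contradiction PC' (none C' C'⊂D)

  maximalAbove : {ℓ : Level} {P : Pred (Subset n) ℓ} → Decidable P →
    {C : Subset n} → P C → ∃[ D ] C ⊆ D × Maximal P D
  maximalAbove {P = P} P? {C} PC with ≺-minimalBelow P? (flip _⊂?_) (flip ⊂-trans) (⊃-wellFounded C) PC
  ... | D , C≼D , PD , none = D , C⊆D C≼D , PD , maximality
    where
    C⊆D : D ≡ C ⊎ C ⊂ D → C ⊆ D
    C⊆D (inj₁ refl) = id
    C⊆D (inj₂ (C⊆D , _)) = C⊆D

    maximality : (C' : Subset n) → P C' → D ⊆ C' → C' ≡ D
    maximality C' PC' D⊆C' with ⊆⇒≡⊎⊂ D⊆C'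
    ... | inj₁ D≡C' = sym D≡C'
    ... | inj₂ D⊂C' = contradiction PC' (none C' D⊂C')

module _ {n : ℕ} (τ : Operator n) where

  isGenerator? : (A : Subset n) → Decidable (IsGenerator τ A)
  isGenerator? A C = ≡-dec _≟ᵇ_ (τ C) (τ A)

  betweenGenerators : Convex τ → {A B G X : Subset n} →
    IsGenerator τ A B → IsGenerator τ A G → B ⊆ X → X ⊆ G → IsGenerator τ A X
  betweenGenerators convex {B = B} {G} {X} genB genG B⊆X X⊆G =
    trans (convex B X G B⊆X X⊆G (trans genB (sym genG))) genB

  -- In a uniquely generated space the basis of A lies inside every generator
  -- of A: the generator contains some basis, and that basis is the basis.
  basis⊆generator : UniquelyGenerated τ → {A B X : Subset n} →
    IsBasis τ A B → IsGenerator τ A X → B ⊆ X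
  basis⊆generator unique {A} {B} {X} basisB genX
    with minimalBelow (isGenerator? A) genX | unique A
  ... | D , D⊆X , basisD | B₀ , _ , onlyB₀ =
    subst (_⊆ X) (trans (onlyB₀ D basisD) (sym (onlyB₀ B basisB))) D⊆X

  generator⊆maxGenerator : UniqueMaxGenerators τ → {A G X : Subset n} →
    IsMaxGenerator τ A G → IsGenerator τ A X → X ⊆ G
  generator⊆maxGenerator unique {A} {G} {X} maxG genX
    with maximalAbove (isGenerator? A) genX | unique A
  ... | D , X⊆D , maxD | G₀ , _ , onlyG₀ =
    subst (X ⊆_) (trans (onlyG₀ D maxD) (sym (onlyG₀ G maxG))) X⊆D

mainTheorem19 : (n : ℕ) (τ : Operator n) → IsConvexSpace τ → UniquelyGenerated τ → UniqueMaxGenerators τ →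
    (A B G : Subset n) → IsBasis τ A B → IsMaxGenerator τ A G →
    (X : Subset n) → (τ X ≡ τ A) ⇔ InInterval B G X
mainTheorem19 n τ (_ , convex) uniqueBasis uniqueMax A B G basisB maxG X = mk⇔ inInterval inClass
  where
  inInterval : τ X ≡ τ A → InInterval B G X
  inInterval genX = basis⊆generator τ uniqueBasis basisB genX
                  , generator⊆maxGenerator τ uniqueMax maxG genX

  inClass : InInterval B G X → τ X ≡ τ A
  inClass (B⊆X , X⊆G) = betweenGenerators τ convex (proj₁ basisB) (proj₁ maxG) B⊆X X⊆G
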